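{- Let $G$ be a connected graph, $H$ a subgraph of $G$, and $d\geq1$, $k\geq2$ integers. (1) If $H$ is an isometric subgraph of $G$, then every $A\subseteq V(H)$ that is a $k$-general $d$-position set in $G$ is a $k$-general $d$-position set in $H$. (2) If $H$ is a convex subgraph of $G$, then for every $A\subseteq V(H)$, $A$ is a $k$-general $d$-position set in $G$ if and only if it is a $k$-general $d$-position set in $H$.
   Context: For a graph $G$, a geodesic is a shortest path between two vertices; its length $\lambda(g)$ is its number of edges and $V(g)$ its vertex set. For $d\ge1$, $k\ge2$, $S\subseteq V(G)$ is a $k$-general $d$-position set in $G$ if every geodesic $g$ of $G$ with $|S\cap V(g)|\geq k$ has $\lambda(g)>d$. A subgraph $H$ of $G$ is isometric if $d_H(u,v)=d_G(u,v)$ for all $u,v\in V(H)$, and convex if it contains every shortest path of $G$ between any two of its vertices. -}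

module Defs where

open import Data.Nat using (ℕ; zero; suc; _≤_; _<_)
open import Data.Fin using (Fin)
open import Data.Fin.Subset using (Subset; _∈_)
open import Data.Fin.Subset.Properties using (_∈?_)
open import Data.List using (List; []; _∷_; length; filter)
open import Data.Product using (Σ; ∃; _×_)
open import Data.Unit using (⊤)
open import Relation.Binary.PropositionalEquality using (_≡_)
open import Relation.Nullary using (¬_)
open import Function.Bundles using (_⇔_)

record Graph (n : ℕ) : Set₁ where
  field
    Adj     : Fin n → Fin n → Set
    sym     : ∀ {u v} → Adj u v → Adj v u
    irrefl  : ∀ {u} → ¬ Adj u u

data Walk {n : ℕ} (E : Fin n → Fin n → Set) : Fin n → Fin n → Set where
  [_]  : (u : Fin n) → Walk E u u
  _∷⟨_⟩_ : (u : Fin n) {v w : Fin n} → E u v → Walk E v w → Walk E u w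

len : ∀ {n} {E : Fin n → Fin n → Set} {u v} → Walk E u v → ℕ
len [ u ] = zero
len (u ∷⟨ e ⟩ g) = suc (len g)

verts : ∀ {n} {E : Fin n → Fin n → Set} {u v} → Walk E u v → List (Fin n)
verts [ u ] = u ∷ []
verts (u ∷⟨ e ⟩ g) = u ∷ verts g

-- |S ∩ V(g)| (a geodesic is a path, so its vertices are distinct)
hits : ∀ {n} {E : Fin n → Fin n → Set} {u v} → Subset n → Walk E u v → ℕ
hits S g = length (filter (_∈? S) (verts g))

IsGeodesic : ∀ {n} (E : Fin n → Fin n → Set) {u v} → Walk E u v → Set
IsGeodesic E {u} {v} g = ∀ (w : Walk E u v) → len g ≤ len w

Dist : ∀ {n} (E : Fin n → Fin n → Set) → Fin n → Fin n → ℕ → Set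
Dist E u v m = Σ (Walk E u v) (λ g → IsGeodesic E g × len g ≡ m)

Connected : ∀ {n} → Graph n → Set
Connected G = ∀ u v → Walk (Graph.Adj G) u v

record Subgraph {n : ℕ} (G : Graph n) : Set₁ where
  field
    VH   : Fin n → Set
    EH   : Fin n → Fin n → Set
    EH-sym : ∀ {u v} → EH u v → EH v u
    EH-⊆ : ∀ {u v} → EH u v → VH u × VH v × Graph.Adj G u v

GenPos : ∀ {n} (V : Fin n → Set) (E : Fin n → Fin n → Set) (k d : ℕ) (S : Subset n) → Set
GenPos V E k d S = ∀ u v → V u → V v → (g : Walk E u v) → IsGeodesic E g → k ≤ hits S g → d < len g

GenPosG : ∀ {n} → Graph n → (k d : ℕ) → Subset n → Set
GenPosG G = GenPos (λ _ → ⊤) (Graph.Adj G)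

GenPosH : ∀ {n} {G : Graph n} → Subgraph G → (k d : ℕ) → Subset n → Set
GenPosH H = GenPos (Subgraph.VH H) (Subgraph.EH H)

_⊆V_ : ∀ {n} {G : Graph n} → Subset n → Subgraph G → Set
A ⊆V H = ∀ x → x ∈ A → Subgraph.VH H x

Isometric : ∀ {n} {G : Graph n} → Subgraph G → Set
Isometric {G = G} H = ∀ u v → Subgraph.VH H u → Subgraph.VH H v → ∀ m →
  Dist (Subgraph.EH H) u v m ⇔ Dist (Graph.Adj G) u v m

data InH {n} {G : Graph n} (H : Subgraph G) : ∀ {u v} → Walk (Graph.Adj G) u v → Set where
  [_]  : ∀ {u} → Subgraph.VH H u → InH H [ u ]
  _∷⟨_⟩_ : ∀ {u v w} {e : Graph.Adj G u v} {g : Walk (Graph.Adj G) v w} →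
         Subgraph.VH H u → Subgraph.EH H u v → InH H g → InH H (u ∷⟨ e ⟩ g)

Convex : ∀ {n} {G : Graph n} → Subgraph G → Set
Convex {G = G} H = ∀ u v → Subgraph.VH H u → Subgraph.VH H v →
  (g : Walk (Graph.Adj G) u v) → IsGeodesic (Graph.Adj G) g → InH H g

-- An H-geodesic between vertices of H is a G-geodesic both when H is isometric
-- (its length is the common distance) and when H is convex (every G-geodesic between
-- its ends lifts to an H-walk of the same length), so a geodesic of H witnessing a
-- violation of general position in H also witnesses one in G.  Conversely, if H is
-- convex, cut a G-geodesic down to the segment between its first and last vertex of
-- A: the segment is again a G-geodesic, has the same number of A-vertices, is no
-- longer, and has both ends in A ⊆ V(H), so it lies in H and is an H-geodesic there.
module Submission where

open import Defs
open import Data.Nat using (ℕ; suc; _≤_; _<_; _+_)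
open import Data.Nat.Properties
open import Data.Nat.Induction using (<-rec)
open import Data.Product using (Σ; ∃; _×_; _,_; proj₂)
open import Data.Fin using (Fin)
open import Data.Fin.Subset using (Subset; _∈_; _∉_)
open import Data.Fin.Subset.Properties using (_∈?_)
open import Data.List using (List; []; _∷_; length; filter)
open import Data.List.Properties using (filter-accept; filter-reject)
open import Data.Unit using (tt)
open import Relation.Nullary using (Dec; yes; no; contradiction)
open import Relation.Binary.PropositionalEquality
open import Function.Bundles using (_⇔_; mk⇔; Equivalence)

module _ {n : ℕ} {E : Fin n → Fin n → Set} where

  infixr 5 _++_

  _++_ : ∀ {u v w} → Walk E u v → Walk E v w → Walk E u w
  [ u ] ++ q = q
  (u ∷⟨ e ⟩ p) ++ q = u ∷⟨ e ⟩ (p ++ q)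

  len-++ : ∀ {u v w} (p : Walk E u v) (q : Walk E v w) → len (p ++ q) ≡ len p + len q
  len-++ [ u ] q = refl
  len-++ (u ∷⟨ e ⟩ p) q = cong suc (len-++ p q)

  len-infix : ∀ {a b c d} (p : Walk E a b) (m : Walk E b c) (q : Walk E c d) →
    len (p ++ m ++ q) ≡ len p + (len m + len q)
  len-infix p m q = trans (len-++ p (m ++ q)) (cong (len p +_) (len-++ m q))

  len-infix-≤ : ∀ {a b c d} (p : Walk E a b) (m : Walk E b c) (q : Walk E c d) →
    len m ≤ len (p ++ m ++ q)
  len-infix-≤ p m q = subst (len m ≤_) (sym (len-infix p m q))
    (≤-trans (m≤m+n (len m) (len q)) (m≤n+m (len m + len q) (len p)))

  geodesic-infix : ∀ {a b c d} (p : Walk E a b) (m : Walk E b c) (q : Walk E c d) →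
    IsGeodesic E (p ++ m ++ q) → IsGeodesic E m
  geodesic-infix p m q geo w =
    +-cancelʳ-≤ (len q) (len m) (len w)
      (+-cancelˡ-≤ (len p) (len m + len q) (len w + len q)
        (subst₂ _≤_ (len-infix p m q) (len-infix p w q) (geo (p ++ w ++ q))))

  -- Constructively we cannot produce a geodesic from u to v, but a lower bound on the
  -- lengths of all geodesics still bounds all walks: by strong induction on len w,
  -- a walk below the bound would be shorter than every other walk, hence a geodesic.
  geodesic-bound⇒walk-bound : ∀ {u v} (b : ℕ) →
    (∀ (h : Walk E u v) → IsGeodesic E h → b ≤ len h) → ∀ (w : Walk E u v) → b ≤ len w
  geodesic-bound⇒walk-bound {u} {v} b bound w = <-rec P step (len w) w refl
    where
    P : ℕ → Set
    P ℓ = ∀ (w : Walk E u v) → len w ≡ ℓ → b ≤ len w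

    step : ∀ ℓ → (∀ {ℓ′} → ℓ′ < ℓ → P ℓ′) → P ℓ
    step ℓ below w refl with b ≤? len w
    ... | yes b≤w = b≤w
    ... | no b≰w = bound w w-geodesic
      where
      w-geodesic : IsGeodesic E w
      w-geodesic w′ with len w ≤? len w′
      ... | yes w≤w′ = w≤w′
      ... | no w≰w′ =
        contradiction (≤-trans (below (≰⇒> w≰w′) w′ refl) (<⇒≤ (≰⇒> w≰w′))) b≰w

module _ {n : ℕ} {E F : Fin n → Fin n → Set} (f : ∀ {u v} → E u v → F u v) where

  map : ∀ {u v} → Walk E u v → Walk F u v
  map [ u ] = [ u ]
  map (u ∷⟨ e ⟩ g) = u ∷⟨ f e ⟩ map g

  len-map : ∀ {u v} (g : Walk E u v) → len (map g) ≡ len g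
  len-map [ u ] = refl
  len-map (u ∷⟨ e ⟩ g) = cong suc (len-map g)

  verts-map : ∀ {u v} (g : Walk E u v) → verts (map g) ≡ verts g
  verts-map [ u ] = refl
  verts-map (u ∷⟨ e ⟩ g) = cong (u ∷_) (verts-map g)

module _ {n : ℕ} (A : Subset n) where

  count : List (Fin n) → ℕ
  count xs = length (filter (_∈? A) xs)

  count-∷-∈ : ∀ {x} xs → x ∈ A → count (x ∷ xs) ≡ suc (count xs)
  count-∷-∈ xs x∈A = cong length (filter-accept (_∈? A) x∈A)

  count-∷-∉ : ∀ {x} xs → x ∉ A → count (x ∷ xs) ≡ count xs
  count-∷-∉ xs x∉A = cong length (filter-reject (_∈? A) x∉A)

  count-∷-cong : ∀ x {xs ys} → count xs ≡ count ys → count (x ∷ xs) ≡ count (x ∷ ys)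
  count-∷-cong x {xs} {ys} eq = by-membership (x ∈? A)
    where
    by-membership : Dec (x ∈ A) → count (x ∷ xs) ≡ count (x ∷ ys)
    by-membership (yes x∈A) = trans (count-∷-∈ xs x∈A) (trans (cong suc eq) (sym (count-∷-∈ ys x∈A)))
    by-membership (no x∉A) = trans (count-∷-∉ xs x∉A) (trans eq (sym (count-∷-∉ ys x∉A)))

  module _ {E : Fin n → Fin n → Set} where

    FirstSplit : ∀ {u v} → Walk E u v → Set
    FirstSplit {u} {v} g = ∃ λ x → x ∈ A × Σ (Walk E u x) λ p → Σ (Walk E x v) λ r →
      g ≡ p ++ r × hits A r ≡ hits A g

    LastSplit : ∀ {u v} → Walk E u v → Set
    LastSplit {u} {v} g = ∃ λ y → y ∈ A × Σ (Walk E u y) λ m → Σ (Walk E y v) λ q →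
      g ≡ m ++ q × hits A m ≡ hits A g

    splitAtFirst : ∀ {u v} (g : Walk E u v) → 1 ≤ hits A g → FirstSplit g
    splitAtFirst {u} g hit with u ∈? A
    ... | yes u∈A = u , u∈A , [ u ] , g , refl , refl
    splitAtFirst [ u ] hit | no u∉A = contradiction (subst (1 ≤_) (count-∷-∉ [] u∉A) hit) λ ()
    splitAtFirst (u ∷⟨ e ⟩ g) hit | no u∉A
      with splitAtFirst g (subst (1 ≤_) (count-∷-∉ (verts g) u∉A) hit)
    ... | x , x∈A , p , r , refl , hits-r =
      x , x∈A , u ∷⟨ e ⟩ p , r , refl , trans hits-r (sym (count-∷-∉ (verts g) u∉A))

    splitAtLast : ∀ {u v} (g : Walk E u v) → 1 ≤ hits A g → LastSplit g
    splitAtLast [ u ] hit = by-membership (u ∈? A)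
      where
      by-membership : Dec (u ∈ A) → LastSplit [ u ]
      by-membership (yes u∈A) = u , u∈A , [ u ] , [ u ] , refl , refl
      by-membership (no u∉A) = contradiction (subst (1 ≤_) (count-∷-∉ [] u∉A) hit) λ ()
    splitAtLast (u ∷⟨ e ⟩ g) hit with 1 ≤? hits A g
    ... | yes hit-g with splitAtLast g hit-g
    ...   | y , y∈A , m , q , refl , hits-m =
      y , y∈A , u ∷⟨ e ⟩ m , q , refl , count-∷-cong u hits-m
    splitAtLast (u ∷⟨ e ⟩ g) hit | no no-hit-g = by-membership (u ∈? A)
      where
      by-membership : Dec (u ∈ A) → LastSplit (u ∷⟨ e ⟩ g)
      by-membership (yes u∈A) = u , u∈A , [ u ] , u ∷⟨ e ⟩ g , refl ,
        trans (count-∷-∈ [] u∈A)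
          (sym (trans (count-∷-∈ (verts g) u∈A) (cong suc (n<1⇒n≡0 (≰⇒> no-hit-g)))))
      by-membership (no u∉A) = contradiction (subst (1 ≤_) (count-∷-∉ (verts g) u∉A) hit) no-hit-g

module _ {n : ℕ} {G : Graph n} (H : Subgraph G) where
  open Graph G using (Adj)
  open Subgraph H using (VH; EH; EH-⊆)

  embed : ∀ {u v} → Walk EH u v → Walk Adj u v
  embed = map (λ e → proj₂ (proj₂ (EH-⊆ e)))

  hits-embed : ∀ (A : Subset n) {u v} (g : Walk EH u v) → hits A (embed g) ≡ hits A g
  hits-embed A g = cong (count A) (verts-map _ g)

  lift : ∀ {u v} {g : Walk Adj u v} → InH H g → Walk EH u v
  lift {g = [ u ]} [ _ ] = [ u ]
  lift {g = u ∷⟨ _ ⟩ _} (_ ∷⟨ e ⟩ i) = u ∷⟨ e ⟩ lift i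

  len-lift : ∀ {u v} {g : Walk Adj u v} (i : InH H g) → len (lift i) ≡ len g
  len-lift [ _ ] = refl
  len-lift (_ ∷⟨ _ ⟩ i) = cong suc (len-lift i)

  verts-lift : ∀ {u v} {g : Walk Adj u v} (i : InH H g) → verts (lift i) ≡ verts g
  verts-lift {g = [ u ]} [ _ ] = refl
  verts-lift {g = u ∷⟨ _ ⟩ _} (_ ∷⟨ _ ⟩ i) = cong (u ∷_) (verts-lift i)

  lift-geodesic : ∀ {u v} {g : Walk Adj u v} (i : InH H g) → IsGeodesic Adj g → IsGeodesic EH (lift i)
  lift-geodesic i geo w =
    subst₂ _≤_ (sym (len-lift i)) (len-map _ w) (geo (embed w))

  PreservesGeodesics : Set
  PreservesGeodesics = ∀ u v → VH u → VH v →
    (g : Walk EH u v) → IsGeodesic EH g → IsGeodesic Adj (embed g)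

  isometric⇒preservesGeodesics : Isometric H → PreservesGeodesics
  isometric⇒preservesGeodesics iso u v u∈H v∈H g geo w
    with Equivalence.to (iso u v u∈H v∈H (len g)) (g , geo , refl)
  ... | h , h-geo , len-h = subst (_≤ len w) (trans len-h (sym (len-map _ g))) (h-geo w)

  convex⇒preservesGeodesics : Convex H → PreservesGeodesics
  convex⇒preservesGeodesics convex u v u∈H v∈H g geo =
    geodesic-bound⇒walk-bound (len (embed g)) embed-g≤geodesic
    where
    embed-g≤geodesic : ∀ h → IsGeodesic Adj h → len (embed g) ≤ len h
    embed-g≤geodesic h h-geo = subst₂ _≤_ (sym (len-map _ g)) (len-lift h∈H) (geo (lift h∈H))
      where h∈H = convex u v u∈H v∈H h h-geo

  preservesGeodesics⇒genPosH : PreservesGeodesics →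
    ∀ k d (A : Subset n) → GenPosG G k d A → GenPosH H k d A
  preservesGeodesics⇒genPosH preserves k d A genPos u v u∈H v∈H g geo k≤hits =
    subst (d <_) (len-map _ g)
      (genPos u v tt tt (embed g) (preserves u v u∈H v∈H g geo)
        (subst (k ≤_) (sym (hits-embed A g)) k≤hits))

  convex⇒genPosG : Convex H → ∀ k d → 1 ≤ k →
    (A : Subset n) → A ⊆V H → GenPosH H k d A → GenPosG G k d A
  convex⇒genPosG convex k d 1≤k A A⊆H genPos u v _ _ g geo k≤hits
    with splitAtFirst A g (≤-trans 1≤k k≤hits)
  ... | x , x∈A , p , r , refl , hits-r
    with splitAtLast A r (subst (1 ≤_) (sym hits-r) (≤-trans 1≤k k≤hits))
  ... | y , y∈A , m , q , refl , hits-m =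
    ≤-trans (subst (d <_) (len-lift m∈H) d<len) (len-infix-≤ p m q)
    where
    m-geo : IsGeodesic Adj m
    m-geo = geodesic-infix p m q geo
    m∈H : InH H m
    m∈H = convex x y (A⊆H x x∈A) (A⊆H y y∈A) m m-geo
    d<len : d < len (lift m∈H)
    d<len = genPos x y (A⊆H x x∈A) (A⊆H y y∈A) (lift m∈H) (lift-geodesic m∈H m-geo)
      (subst (k ≤_) (sym (trans (cong (count A) (verts-lift m∈H)) (trans hits-m hits-r))) k≤hits)

lemma2p6 : ∀ {n} (G : Graph n) → Connected G → (H : Subgraph G) → (d k : ℕ) → 1 ≤ d → 2 ≤ k →
    ((Isometric H → ∀ (A : Subset n) → A ⊆V H → GenPosG G k d A → GenPosH H k d A)
    × (Convex H → ∀ (A : Subset n) → A ⊆V H → (GenPosG G k d A ⇔ GenPosH H k d A)))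
lemma2p6 G _ H d k _ 2≤k =
  (λ iso A _ → preservesGeodesics⇒genPosH H (isometric⇒preservesGeodesics H iso) k d A) ,
  (λ convex A A⊆H → mk⇔
    (preservesGeodesics⇒genPosH H (convex⇒preservesGeodesics H convex) k d A)
    (convex⇒genPosG H convex k d (<⇒≤ 2≤k) A A⊆H))
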